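{- Let $(S,\cdot)$ be an arbitrary semigroup and let $A\subseteq S$ be an $SCR$-set in $S$. Then the collection $D=\{(a_1,a_2,d)\in S\times S\times S: \{a_1d^ta_2: t\in\{1,2\}\}\subseteq A\}$ is a $CR$-set in the semigroup $S\times S\times S$ (with coordinatewise operation).
   Context: For a semigroup $T$, ${}^{\mathbb{N}}T$ denotes the set of functions $f:\mathbb{N}\to T$ and $\mathcal{P}_f(X)$ the set of finite nonempty subsets of $X$. A set $A\subseteq S$ is an $SCR$-set (strong combinatorially rich set) if for each $k\in\mathbb{N}$ there exists $r\in\mathbb{N}$ such that for each $F\in\mathcal{P}_f({}^{\mathbb{N}}S)$ with $|F|\le k$, there exist $(a_1,a_2)\in S^2$ and $t\in\mathbb{N}$ with $t\le r$ such that $a_1f(t)a_2\in A$ for each $f\in F$. A set $B\subseteq T$ in a semigroup $T$ is a $CR$-set (combinatorially rich set) if for each $k\in\mathbb{N}$ there exist $r\in\mathbb{N}$ and $m\in\mathbb{N}$ such that for each $F\in\mathcal{P}_f({}^{\mathbb{N}}T)$ with $|F|\le k$, there exist $(a_1,\dots,a_{m+1})\in T^{m+1}$ and $t_1<t_2<\dots<t_m\le r$ in $\mathbb{N}$ such that $a_1f(t_1)a_2f(t_2)\cdots a_mf(t_m)a_{m+1}\in B$ for each $f\in F$. -}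

module Defs where

open import Level using (Level; _⊔_)
open import Algebra.Bundles using (Semigroup)
open import Algebra.Construct.DirectProduct using (semigroup)
open import Data.Nat using (ℕ; zero; suc; _≤_; _<_)
open import Data.Fin as Fin using (Fin)
open import Data.Product using (Σ; _×_; _,_; ∃-syntax)
open import Relation.Unary using (Pred; _∈_)
open import Relation.Binary.Definitions using (_Respects_)

-- Functions ℕ → S play the role of ^ℕ S.  The paper's ℕ = {1,2,...};
-- we use Agda's ℕ for the domain but only ever evaluate at indices t ≥ 1,
-- so the value at 0 is irrelevant.

module _ {c ℓ : Level} (S : Semigroup c ℓ) where
  open Semigroup S renaming (Carrier to C)

  word : ∀ {m} → (Fin (suc m) → C) → (Fin m → ℕ) → (ℕ → C) → C
  word {zero}  a t f = a Fin.zero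
  word {suc m} a t f = a Fin.zero ∙ (f (t Fin.zero) ∙ word (λ i → a (Fin.suc i)) (λ i → t (Fin.suc i)) f)

  -- SCR-set.  A finite nonempty F ⊆ ^ℕ S with |F| ≤ k is given as an
  -- enumeration F : Fin n → (ℕ → S) with 1 ≤ n ≤ k (repetitions are harmless,
  -- since the condition is "for each f ∈ F").
  IsSCR : ∀ {p} → Pred C p → Set (c ⊔ p)
  IsSCR A =
    (k : ℕ) → 1 ≤ k →
    ∃[ r ] (1 ≤ r ×
      ((n : ℕ) → 1 ≤ n → n ≤ k → (F : Fin n → (ℕ → C)) →
        ∃[ a₁ ] ∃[ a₂ ] ∃[ t ] (1 ≤ t × t ≤ r ×
          ((i : Fin n) → (a₁ ∙ F i t) ∙ a₂ ∈ A))))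

  IsCR : ∀ {p} → Pred C p → Set (c ⊔ p)
  IsCR B =
    (k : ℕ) → 1 ≤ k →
    ∃[ r ] ∃[ m ] (1 ≤ r × 1 ≤ m ×
      ((n : ℕ) → 1 ≤ n → n ≤ k → (F : Fin n → (ℕ → C)) →
        Σ (Fin (suc m) → C) λ a → Σ (Fin m → ℕ) λ t →
          ((i : Fin m) → 1 ≤ t i) ×
          ((i : Fin m) → t i ≤ r) ×
          ((i j : Fin m) → i Fin.< j → t i < t j) ×
          ((i : Fin n) → word a t (F i) ∈ B)))

  S³ : Semigroup c ℓ
  S³ = semigroup S (semigroup S S)

  D : ∀ {p} → Pred C p → Pred (Semigroup.Carrier S³) p
  D A (a₁ , (a₂ , d)) = ((a₁ ∙ d) ∙ a₂ ∈ A) × ((a₁ ∙ (d ∙ d)) ∙ a₂ ∈ A)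

{-# OPTIONS --safe #-}
-- Apply the SCR property of A, at twice the size, to the 2n functions
--   t ↦ x e · (e d e) · e y   and   t ↦ x e · (e d e)(e d e) · e y,
-- where f(t) = (x, y, d) runs over the given functions into S³ and e ∈ S is any
-- fixed element.  The resulting a₁, a₂, t give the single-step CR pattern
--   (a₁, e, e) · f(t) · (e, a₂, e) = (a₁ x e, e y a₂, e d e),
-- and a₁ x e · (e d e)ˢ · e y a₂ ∈ A for s = 1, 2 is exactly membership in D.
module Submission where

open import Defs
open import Level using (Level; _⊔_)
open import Algebra.Bundles using (Semigroup)
open import Relation.Unary using (Pred; _∈_)
open import Relation.Binary.Definitions using (_Respects_)
open import Data.Nat using (ℕ; _≤_; _+_; z≤n; s≤s)
open import Data.Nat.Properties using (≤-trans; m≤m+n; +-mono-≤)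
open import Data.Fin as Fin using (Fin; splitAt; _↑ˡ_; _↑ʳ_)
open import Data.Fin.Properties using (splitAt-↑ˡ; splitAt-↑ʳ)
open import Data.Sum using ([_,_]′)
open import Data.Product using (_×_; _,_; ∃-syntax)
open import Relation.Binary.PropositionalEquality using (subst)
import Relation.Binary.Reasoning.Setoid as SetoidReasoning

module _ {c ℓ : Level} (S : Semigroup c ℓ) where
  open Semigroup S renaming (Carrier to C)

  IsCR₁ : ∀ {p} → Pred C p → Set (c ⊔ p)
  IsCR₁ B =
    (k : ℕ) → 1 ≤ k →
    ∃[ r ] (1 ≤ r ×
      ((n : ℕ) → 1 ≤ n → n ≤ k → (F : Fin n → (ℕ → C)) →
        ∃[ b₁ ] ∃[ b₂ ] ∃[ t ] (1 ≤ t × t ≤ r ×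
          ((i : Fin n) → b₁ ∙ (F i t ∙ b₂) ∈ B))))

  IsCR₁⇒IsCR : ∀ {p} {B : Pred C p} → IsCR₁ B → IsCR S B
  IsCR₁⇒IsCR cr₁ k k≥1 =
    let r , r≥1 , hit = cr₁ k k≥1 in
    r , 1 , r≥1 , s≤s z≤n , λ n n≥1 n≤k F →
      let b₁ , b₂ , t , t≥1 , t≤r , B∋ = hit n n≥1 n≤k F in
      (λ { Fin.zero → b₁ ; (Fin.suc _) → b₂ }) , (λ _ → t) ,
      (λ _ → t≥1) , (λ _ → t≤r) , (λ { Fin.zero Fin.zero () }) , B∋

module _ {c ℓ : Level} (S : Semigroup c ℓ) where
  open Semigroup S renaming (Carrier to C)
  open Semigroup (S³ S) using () renaming (Carrier to C³; _∙_ to _∙³_)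

  IsSCR⇒hitsPairs : ∀ {p} {A : Pred C p} → IsSCR S A →
    (k : ℕ) → 1 ≤ k →
    ∃[ r ] (1 ≤ r ×
      ((n : ℕ) → 1 ≤ n → n ≤ k → (g h : Fin n → (ℕ → C)) →
        ∃[ a₁ ] ∃[ a₂ ] ∃[ t ] (1 ≤ t × t ≤ r ×
          ((i : Fin n) → (a₁ ∙ g i t) ∙ a₂ ∈ A × (a₁ ∙ h i t) ∙ a₂ ∈ A))))
  IsSCR⇒hitsPairs {A = A} scr k k≥1 =
    let r , r≥1 , hit = scr (k + k) (≤-trans k≥1 (m≤m+n k k)) in
    r , r≥1 , λ n n≥1 n≤k g h →
      let G = λ j → [ g , h ]′ (splitAt n j)
          a₁ , a₂ , t , t≥1 , t≤r , A∋ =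
            hit (n + n) (≤-trans n≥1 (m≤m+n n n)) (+-mono-≤ n≤k n≤k) G
          A∋G = λ j → (a₁ ∙ [ g , h ]′ j t) ∙ a₂ ∈ A
      in a₁ , a₂ , t , t≥1 , t≤r , λ i →
        subst A∋G (splitAt-↑ˡ n i n) (A∋ (i ↑ˡ n)) ,
        subst A∋G (splitAt-↑ʳ n n i) (A∋ (n ↑ʳ i))

  reassoc : ∀ a u m v w b → (a ∙ ((u ∙ m) ∙ (v ∙ w))) ∙ b ≈ ((a ∙ u) ∙ m) ∙ (v ∙ (w ∙ b))
  reassoc a u m v w b = begin
    (a ∙ ((u ∙ m) ∙ (v ∙ w))) ∙ b  ≈⟨ assoc a _ b ⟩
    a ∙ (((u ∙ m) ∙ (v ∙ w)) ∙ b)  ≈⟨ ∙-congˡ (assoc (u ∙ m) (v ∙ w) b) ⟩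
    a ∙ ((u ∙ m) ∙ ((v ∙ w) ∙ b))  ≈⟨ sym (assoc a (u ∙ m) _) ⟩
    (a ∙ (u ∙ m)) ∙ ((v ∙ w) ∙ b)  ≈⟨ ∙-cong (sym (assoc a u m)) (assoc v w b) ⟩
    ((a ∙ u) ∙ m) ∙ (v ∙ (w ∙ b))  ∎
    where open SetoidReasoning setoid

  module _ {p} (A : Pred C p) (A-resp : A Respects _≈_) where

    spacer : C → C → C
    spacer e d = e ∙ (d ∙ e)

    oneSpacer twoSpacers : C → C³ → C
    oneSpacer  e (x , (y , d)) = ((x ∙ e) ∙ spacer e d) ∙ (e ∙ y)
    twoSpacers e (x , (y , d)) = ((x ∙ e) ∙ (spacer e d ∙ spacer e d)) ∙ (e ∙ y)

    spacers∈D : ∀ e a₁ a₂ z →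
      (a₁ ∙ oneSpacer e z) ∙ a₂ ∈ A → (a₁ ∙ twoSpacers e z) ∙ a₂ ∈ A →
      (a₁ , (e , e)) ∙³ (z ∙³ (e , (a₂ , e))) ∈ D S A
    spacers∈D e a₁ a₂ (x , (y , d)) A∋once A∋twice =
      A-resp (reassoc a₁ (x ∙ e) (spacer e d) e y a₂) A∋once ,
      A-resp (reassoc a₁ (x ∙ e) (spacer e d ∙ spacer e d) e y a₂) A∋twice

    D-isCR₁ : IsSCR S A → IsCR₁ (S³ S) (D S A)
    D-isCR₁ scr k k≥1 =
      let r , r≥1 , hit = IsSCR⇒hitsPairs {A = A} scr k k≥1 in
      r , r≥1 , λ n n≥1 n≤k F →
        let e , _ = F (Fin.fromℕ< n≥1) 0  -- any element; S may be empty, so it comes from F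
            a₁ , a₂ , t , t≥1 , t≤r , A∋ =
              hit n n≥1 n≤k (λ i t → oneSpacer e (F i t)) (λ i t → twoSpacers e (F i t))
        in (a₁ , (e , e)) , (e , (a₂ , e)) , t , t≥1 , t≤r , λ i →
          let A∋once , A∋twice = A∋ i in spacers∈D e a₁ a₂ (F i t) A∋once A∋twice

theorem2p7 : {c ℓ p : Level} (S : Semigroup c ℓ) (A : Pred (Semigroup.Carrier S) p) →
    A Respects (Semigroup._≈_ S) →
    IsSCR S A → IsCR (S³ S) (D S A)
theorem2p7 S A A-resp scr = IsCR₁⇒IsCR (S³ S) {B = D S A} (D-isCR₁ S A A-resp scr)
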